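{- For all integers $n\geq 0$ and $s\geq 0$, \[ac(n,2s+1)=\sum_{j=0}^{n-1}ac(j,2s),\] where for $n=0$ the empty sum is $0$.
   Context: A composition of $n$ of length $s$ is a sequence $\sigma=(\sigma_1,\ldots,\sigma_s)$ of positive integers with $\sum_i\sigma_i=n$; the empty composition is the unique composition of $0$, of length $0$. A composition is anti-palindromic if $\sigma_i\neq\sigma_{s-i+1}$ for all $i$ with $i\neq\frac{s+1}{2}$ (the empty composition is vacuously anti-palindromic). $ac(n,s)$ is the number of anti-palindromic compositions of $n$ of length $s$. -}

module Defs where

open import Data.Nat using (ℕ; zero; suc; _+_; _≟_)
open import Data.Fin using (Fin; opposite)
import Data.Fin.Properties as FinP
open import Data.Vec using (Vec; []; _∷_; lookup; sum)
open import Data.List using (List; []; _∷_; map; concatMap; filter; length; applyUpTo)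
open import Data.Product using (_×_; _,_)
open import Relation.Binary.PropositionalEquality using (_≡_)
open import Relation.Nullary using (¬_; Dec; _×-dec_; _→-dec_; ¬?)
open import Relation.Unary using (Decidable)

IsComposition : (n s : ℕ) → Vec ℕ s → Set
IsComposition n s σ = ((i : Fin s) → ¬ (lookup σ i ≡ 0)) × (sum σ ≡ n)

-- Anti-palindromic: σ_i ≠ σ_{s-i+1} for every (0-based) i with i ≠ s-1-i,
-- i.e. except for the middle index when s is odd.
IsAntiPalindromic : (s : ℕ) → Vec ℕ s → Set
IsAntiPalindromic s σ =
  (i : Fin s) → ¬ (i ≡ opposite i) → ¬ (lookup σ i ≡ lookup σ (opposite i))

isComposition? : (n s : ℕ) → Decidable (IsComposition n s)
isComposition? n s σ = FinP.all? (λ i → ¬? (lookup σ i ≟ 0)) ×-dec (sum σ ≟ n)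

isAntiPalindromic? : (s : ℕ) → Decidable (IsAntiPalindromic s)
isAntiPalindromic? s σ =
  FinP.all? (λ i → ¬? (i FinP.≟ opposite i) →-dec ¬? (lookup σ i ≟ lookup σ (opposite i)))

-- All vectors of length s with entries in {1,…,n}; every composition of n
-- of length s occurs exactly once in this list.
candidates : (n s : ℕ) → List (Vec ℕ s)
candidates n zero = [] ∷ []
candidates n (suc s) =
  concatMap (λ a → map (a ∷_) (candidates n s)) (applyUpTo suc n)

ac : ℕ → ℕ → ℕ
ac n s = length (filter (λ σ → isComposition? n s σ ×-dec isAntiPalindromic? s σ)
                        (candidates n s))

sumBelow : ℕ → (ℕ → ℕ) → ℕ
sumBelow zero    f = 0
sumBelow (suc n) f = sumBelow n f + f n

{-# OPTIONS --safe #-}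
-- In odd length 2s+1 the middle index is the only one fixed by i ↦ opposite i, and
-- deleting it commutes with opposite on the other indices. Hence deleting the middle
-- entry m of an anti-palindromic composition of n leaves an anti-palindromic composition
-- of j = n − m < n of length 2s, and conversely every such composition of j < n arises
-- exactly once, with middle entry n − j.
module Submission where

open import Defs
open import Data.Nat using (ℕ; zero; suc; _+_; _*_; _∸_; _≤_; _<_; s≤s; _<?_; _≟_)
open import Data.Nat.Properties
open import Algebra.Properties.CommutativeSemigroup +-commutativeSemigroup using (x∙yz≈y∙xz)
open import Data.Fin using (Fin; zero; suc; toℕ; opposite; punchIn; punchOut; fromℕ<)
open import Data.Fin.Properties
  using (toℕ-injective; toℕ<n; toℕ-fromℕ<; opposite-prop; opposite-involutive;
         punchInᵢ≢i; punchIn-punchOut)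
  renaming (_≟_ to _≟ᶠ_)
import Data.Vec as Vec
open Vec using (Vec; []; _∷_; lookup; sum; insertAt; removeAt)
open import Data.Vec.Properties
  using (∷-injective; insertAt-lookup; insertAt-punchIn; removeAt-insertAt; insertAt-removeAt)
open import Data.List
  using (List; []; _∷_; map; concatMap; filter; length; applyUpTo; cartesianProductWith; _++_)
open import Data.List.Properties using (length-++; length-map)
open import Data.List.Membership.Propositional using (_∈_)
open import Data.List.Membership.Propositional.Properties
  using (∈-map⁺; ∈-map⁻; ∈-++⁺ˡ; ∈-++⁺ʳ; ∈-++⁻; ∈-filter⁺; ∈-filter⁻; ∈-applyUpTo⁺;
         ∈-cartesianProductWith⁺)
open import Data.List.Membership.Propositional.Properties.WithK using (unique∧set⇒bag)
open import Data.List.Relation.Unary.All using ([])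
open import Data.List.Relation.Unary.Any using (here)
open import Data.List.Relation.Unary.Unique.Propositional using (Unique; []; _∷_)
import Data.List.Relation.Unary.Unique.Propositional.Properties as Unique
open import Data.List.Relation.Binary.BagAndSetEquality using (∼bag⇒↭)
open import Data.List.Relation.Binary.Permutation.Propositional.Properties using (↭-length)
open import Data.Product using (_×_; _,_; proj₁; proj₂)
open import Data.Sum using (inj₁; inj₂)
open import Function using (_∘_)
open import Function.Bundles using (_⇔_; mk⇔; Equivalence)
open import Function.Construct.Symmetry using (⇔-sym)
open import Function.Construct.Composition using (_⇔-∘_)
open import Relation.Binary.PropositionalEquality
open import Relation.Nullary using (yes; no; contradiction; _×-dec_)
open import Relation.Unary using (Decidable)

length-≡-of-same-members : ∀ {a} {A : Set a} {xs ys : List A} → Unique xs → Unique ys →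
                           (∀ {x} → x ∈ xs ⇔ x ∈ ys) → length xs ≡ length ys
length-≡-of-same-members uxs uys same = ↭-length (∼bag⇒↭ (unique∧set⇒bag uxs uys same))

concatMap-map≡cartesianProductWith :
  ∀ {a b c} {A : Set a} {B : Set b} {C : Set c} (f : A → B → C) xs ys →
  concatMap (λ x → map (f x) ys) xs ≡ cartesianProductWith f xs ys
concatMap-map≡cartesianProductWith f []       ys = refl
concatMap-map≡cartesianProductWith f (x ∷ xs) ys =
  cong (map (f x) ys ++_) (concatMap-map≡cartesianProductWith f xs ys)

candidates-suc : ∀ n s →
  candidates n (suc s) ≡ cartesianProductWith Vec._∷_ (applyUpTo suc n) (candidates n s)
candidates-suc n s = concatMap-map≡cartesianProductWith Vec._∷_ (applyUpTo suc n) (candidates n s)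

candidates-unique : ∀ n s → Unique (candidates n s)
candidates-unique n zero    = [] ∷ []
candidates-unique n (suc s) = subst Unique (sym (candidates-suc n s))
  (Unique.cartesianProductWith⁺ Vec._∷_ ∷-injective
    (Unique.applyUpTo⁺₁ suc n (λ i<j _ → <⇒≢ (s≤s i<j))) (candidates-unique n s))

∈-candidates : ∀ {n s} (σ : Vec ℕ s) → (∀ i → lookup σ i ≢ 0) → sum σ ≤ n → σ ∈ candidates n s
∈-candidates []           _   _   = here refl
∈-candidates (zero  ∷ σ)  pos _   = contradiction refl (pos zero)
∈-candidates {n} {suc s} (suc a ∷ σ) pos a+σ≤n =
  subst (suc a ∷ σ ∈_) (sym (candidates-suc n s))
    (∈-cartesianProductWith⁺ Vec._∷_ (∈-applyUpTo⁺ suc (m+n≤o⇒m≤o (suc a) a+σ≤n))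
                                      (∈-candidates σ (pos ∘ suc) (m+n≤o⇒n≤o (suc a) a+σ≤n)))

AntiPalindromicComposition : ℕ → (k : ℕ) → Vec ℕ k → Set
AntiPalindromicComposition n k σ = IsComposition n k σ × IsAntiPalindromic k σ

antiPalindromicComposition? : ∀ n k → Decidable (AntiPalindromicComposition n k)
antiPalindromicComposition? n k σ = isComposition? n k σ ×-dec isAntiPalindromic? k σ

antiPalindromicCompositions : ℕ → (k : ℕ) → List (Vec ℕ k)
antiPalindromicCompositions n k = filter (antiPalindromicComposition? n k) (candidates n k)

∈-antiPalindromicCompositions : ∀ {n k σ} →
  σ ∈ antiPalindromicCompositions n k ⇔ AntiPalindromicComposition n k σ
∈-antiPalindromicCompositions {n} {k} {σ} = mk⇔
  (proj₂ ∘ ∈-filter⁻ (antiPalindromicComposition? n k) {xs = candidates n k})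
  (λ apc@((pos , σ≡n) , _) →
     ∈-filter⁺ (antiPalindromicComposition? n k) (∈-candidates σ pos (≤-reflexive σ≡n)) apc)

antiPalindromicCompositions-unique : ∀ n k → Unique (antiPalindromicCompositions n k)
antiPalindromicCompositions-unique n k = Unique.filter⁺ _ (candidates-unique n k)

ac-≡-length-of-enumeration : ∀ {n k} {xs : List (Vec ℕ k)} → Unique xs →
  (∀ {σ} → σ ∈ xs ⇔ AntiPalindromicComposition n k σ) → ac n k ≡ length xs
ac-≡-length-of-enumeration {n} {k} uxs ∈xs =
  length-≡-of-same-members (antiPalindromicCompositions-unique n k) uxs
    (⇔-sym ∈xs ⇔-∘ ∈-antiPalindromicCompositions)

toℕ-punchIn-< : ∀ {n} (i : Fin (suc n)) (j : Fin n) → toℕ j < toℕ i → toℕ (punchIn i j) ≡ toℕ j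
toℕ-punchIn-< (suc i) zero    _          = refl
toℕ-punchIn-< (suc i) (suc j) (s≤s j<i) = cong suc (toℕ-punchIn-< i j j<i)

toℕ-punchIn-≥ : ∀ {n} (i : Fin (suc n)) (j : Fin n) → toℕ i ≤ toℕ j → toℕ (punchIn i j) ≡ suc (toℕ j)
toℕ-punchIn-≥ zero    j       _          = refl
toℕ-punchIn-≥ (suc i) (suc j) (s≤s i≤j) = cong suc (toℕ-punchIn-≥ i j i≤j)

toℕ-opposite-sum : ∀ {n} (i : Fin n) → suc (toℕ i + toℕ (opposite i)) ≡ n
toℕ-opposite-sum i = trans (cong (suc (toℕ i) +_) (opposite-prop i)) (m+[n∸m]≡n (toℕ<n i))

toℕ-opposite-unique : ∀ {n} (i : Fin n) {c} → suc (toℕ i + c) ≡ n → toℕ (opposite i) ≡ c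
toℕ-opposite-unique i e = +-cancelˡ-≡ (toℕ i) _ _ (suc-injective (trans (toℕ-opposite-sum i) (sym e)))

2*n≡n+n : ∀ n → 2 * n ≡ n + n
2*n≡n+n n = cong (n +_) (+-identityʳ n)

opposite-fixed⇒odd : ∀ {n} {i : Fin n} → i ≡ opposite i → suc (2 * toℕ i) ≡ n
opposite-fixed⇒odd {i = i} i≡i′ =
  trans (cong suc (2*n≡n+n (toℕ i)))
        (subst (λ j → suc (toℕ i + toℕ j) ≡ _) (sym i≡i′) (toℕ-opposite-sum i))

below-half⇒above-half : ∀ {t u s} → suc (t + u) ≡ 2 * s → t < s → s ≤ u
below-half⇒above-half {t} {u} {s} e t<s = +-cancelˡ-≤ s s u (begin
  s + s      ≡⟨ 2*n≡n+n s ⟨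
  2 * s      ≡⟨ e ⟨
  suc t + u  ≤⟨ +-monoˡ-≤ u t<s ⟩
  s + u      ∎)
  where open ≤-Reasoning

above-half⇒below-half : ∀ {t u s} → suc (t + u) ≡ 2 * s → s ≤ t → u < s
above-half⇒below-half {t} {u} {s} e s≤t = +-cancelˡ-≤ s (suc u) s (begin
  s + suc u  ≤⟨ +-monoˡ-≤ (suc u) s≤t ⟩
  t + suc u  ≡⟨ +-suc t u ⟩
  suc (t + u) ≡⟨ e ⟩
  2 * s      ≡⟨ 2*n≡n+n s ⟩
  s + s      ∎)
  where open ≤-Reasoning

sum-insertAt : ∀ {n} (v : Vec ℕ n) i x → sum (insertAt v i x) ≡ x + sum v
sum-insertAt v       zero    x = refl
sum-insertAt (y ∷ v) (suc i) x = trans (cong (y +_) (sum-insertAt v i x)) (x∙yz≈y∙xz y x (sum v))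

all-lookup-insertAt : ∀ {a p} {A : Set a} (P : A → Set p) {n} (v : Vec A n) i x →
  (∀ j → P (lookup (insertAt v i x) j)) ⇔ (P x × ∀ j → P (lookup v j))
all-lookup-insertAt P v i x = mk⇔
  (λ Pw → subst P (insertAt-lookup v i x) (Pw i) ,
          λ j → subst P (insertAt-punchIn v i x j) (Pw (punchIn i j)))
  (λ (Px , Pv) → fill Px Pv)
  where
  fill : P x → (∀ j → P (lookup v j)) → ∀ j → P (lookup (insertAt v i x) j)
  fill Px Pv j with i ≟ᶠ j
  ... | yes refl = subst P (sym (insertAt-lookup v i x)) Px
  ... | no  i≢j  = subst (P ∘ lookup (insertAt v i x)) (punchIn-punchOut i≢j)
                         (subst P (sym (insertAt-punchIn v i x (punchOut i≢j))) (Pv (punchOut i≢j)))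

module Middle (s : ℕ) where

  middle : Fin (suc (2 * s))
  middle = fromℕ< (s≤s (m≤m+n s (s + 0)))

  toℕ-middle : toℕ middle ≡ s
  toℕ-middle = toℕ-fromℕ< _

  middle≡opposite-middle : middle ≡ opposite middle
  middle≡opposite-middle = toℕ-injective (trans toℕ-middle (sym (toℕ-opposite-unique middle
    (cong suc (trans (cong (_+ s) toℕ-middle) (sym (2*n≡n+n s)))))))

  opposite-fixed⇒middle : ∀ {i : Fin (suc (2 * s))} → i ≡ opposite i → i ≡ middle
  opposite-fixed⇒middle i≡i′ =
    toℕ-injective (trans (*-cancelˡ-≡ _ s 2 (suc-injective (opposite-fixed⇒odd i≡i′))) (sym toℕ-middle))

  opposite-unfixed : (i : Fin (2 * s)) → i ≢ opposite i
  opposite-unfixed i i≡i′ = even≢odd s (toℕ i) (sym (opposite-fixed⇒odd i≡i′))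

  opposite-punchIn-below : (i : Fin (2 * s)) → toℕ i < s →
                           opposite (punchIn middle i) ≡ punchIn middle (opposite i)
  opposite-punchIn-below i t<s = toℕ-injective (begin
    toℕ (opposite (punchIn middle i))  ≡⟨ toℕ-opposite-unique (punchIn middle i) sum≡ ⟩
    suc (toℕ (opposite i))             ≡⟨ toℕ-punchIn-≥ middle (opposite i) middle≤u ⟨
    toℕ (punchIn middle (opposite i))  ∎)
    where
    open ≡-Reasoning
    i<middle : toℕ i < toℕ middle
    i<middle = subst (toℕ i <_) (sym toℕ-middle) t<s
    middle≤u : toℕ middle ≤ toℕ (opposite i)
    middle≤u = subst (_≤ toℕ (opposite i)) (sym toℕ-middle)
                     (below-half⇒above-half (toℕ-opposite-sum i) t<s)
    sum≡ : suc (toℕ (punchIn middle i) + suc (toℕ (opposite i))) ≡ suc (2 * s)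
    sum≡ = cong suc (begin
      toℕ (punchIn middle i) + suc (toℕ (opposite i))
        ≡⟨ cong (_+ suc (toℕ (opposite i))) (toℕ-punchIn-< middle i i<middle) ⟩
      toℕ i + suc (toℕ (opposite i))  ≡⟨ +-suc (toℕ i) _ ⟩
      suc (toℕ i + toℕ (opposite i))  ≡⟨ toℕ-opposite-sum i ⟩
      2 * s                           ∎)

  opposite-punchIn : (i : Fin (2 * s)) → opposite (punchIn middle i) ≡ punchIn middle (opposite i)
  opposite-punchIn i with toℕ i <? s
  ... | yes t<s = opposite-punchIn-below i t<s
  ... | no  t≮s = begin
    opposite (punchIn middle i)
      ≡⟨ cong (opposite ∘ punchIn middle) (opposite-involutive i) ⟨
    opposite (punchIn middle (opposite (opposite i)))
      ≡⟨ cong opposite (opposite-punchIn-below (opposite i) u<s) ⟨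
    opposite (opposite (punchIn middle (opposite i)))
      ≡⟨ opposite-involutive _ ⟩
    punchIn middle (opposite i)
      ∎
    where
    open ≡-Reasoning
    u<s : toℕ (opposite i) < s
    u<s = above-half⇒below-half (toℕ-opposite-sum i) (≮⇒≥ t≮s)

  module _ (v : Vec ℕ (2 * s)) (m : ℕ) where

    private
      w : Vec ℕ (suc (2 * s))
      w = insertAt v middle m

    lookup-insertAt-middle-opposite : ∀ i → lookup w (opposite (punchIn middle i)) ≡ lookup v (opposite i)
    lookup-insertAt-middle-opposite i =
      trans (cong (lookup w) (opposite-punchIn i)) (insertAt-punchIn v middle m (opposite i))

    antiPalindromic-insertAt-middle : IsAntiPalindromic (suc (2 * s)) w ⇔ IsAntiPalindromic (2 * s) v
    antiPalindromic-insertAt-middle = mk⇔ to from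
      where
      to : IsAntiPalindromic (suc (2 * s)) w → IsAntiPalindromic (2 * s) v
      to apw i _ vᵢ≡vᵢ′ = apw (punchIn middle i) (punchInᵢ≢i middle i ∘ opposite-fixed⇒middle)
        (trans (insertAt-punchIn v middle m i) (trans vᵢ≡vᵢ′ (sym (lookup-insertAt-middle-opposite i))))

      off-middle : IsAntiPalindromic (2 * s) v →
                   ∀ i → lookup w (punchIn middle i) ≢ lookup w (opposite (punchIn middle i))
      off-middle apv i wᵢ≡wᵢ′ = apv i (opposite-unfixed i)
        (trans (sym (insertAt-punchIn v middle m i)) (trans wᵢ≡wᵢ′ (lookup-insertAt-middle-opposite i)))

      from : IsAntiPalindromic (2 * s) v → IsAntiPalindromic (suc (2 * s)) w
      from apv j j≢j′ = subst (λ k → lookup w k ≢ lookup w (opposite k))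
                              (punchIn-punchOut middle≢j) (off-middle apv (punchOut middle≢j))
        where
        middle≢j : middle ≢ j
        middle≢j middle≡j = j≢j′ (subst (λ k → k ≡ opposite k) middle≡j middle≡opposite-middle)

  module _ {n : ℕ} (τ : Vec ℕ (2 * s)) (m : ℕ) where

    antiPalindromicComposition-insertAt-middle⁺ : ∀ {j} → m ≢ 0 → m + j ≡ n →
      AntiPalindromicComposition j (2 * s) τ → AntiPalindromicComposition n (suc (2 * s)) (insertAt τ middle m)
    antiPalindromicComposition-insertAt-middle⁺ m≢0 m+j≡n ((posτ , τ≡j) , apτ) =
      ( Equivalence.from (all-lookup-insertAt (_≢ 0) τ middle m) (m≢0 , posτ)
      , trans (sum-insertAt τ middle m) (trans (cong (m +_) τ≡j) m+j≡n) )
      , Equivalence.from (antiPalindromic-insertAt-middle τ m) apτ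

    antiPalindromicComposition-insertAt-middle⁻ :
      AntiPalindromicComposition n (suc (2 * s)) (insertAt τ middle m) →
      m ≢ 0 × m + sum τ ≡ n × AntiPalindromicComposition (sum τ) (2 * s) τ
    antiPalindromicComposition-insertAt-middle⁻ ((posσ , σ≡n) , apσ) =
      proj₁ pos , trans (sym (sum-insertAt τ middle m)) σ≡n
      , (proj₂ pos , refl) , Equivalence.to (antiPalindromic-insertAt-middle τ m) apσ
      where
      pos : m ≢ 0 × (∀ i → lookup τ i ≢ 0)
      pos = Equivalence.to (all-lookup-insertAt (_≢ 0) τ middle m) posσ

module Enumeration (s N : ℕ) where
  open Middle s

  outerSum : Vec ℕ (suc (2 * s)) → ℕ
  outerSum σ = sum (removeAt σ middle)

  block : ℕ → List (Vec ℕ (suc (2 * s)))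
  block j = map (λ τ → insertAt τ middle (N ∸ j)) (antiPalindromicCompositions j (2 * s))

  withOuterSumBelow : ℕ → List (Vec ℕ (suc (2 * s)))
  withOuterSumBelow zero    = []
  withOuterSumBelow (suc j) = withOuterSumBelow j ++ block j

  length-withOuterSumBelow : ∀ j → length (withOuterSumBelow j) ≡ sumBelow j (λ i → ac i (2 * s))
  length-withOuterSumBelow zero    = refl
  length-withOuterSumBelow (suc j) = trans (length-++ (withOuterSumBelow j))
    (cong₂ _+_ (length-withOuterSumBelow j) (length-map _ (antiPalindromicCompositions j (2 * s))))

  outerSum-block : ∀ {j σ} → σ ∈ block j → outerSum σ ≡ j
  outerSum-block {j} σ∈ with ∈-map⁻ _ σ∈
  ... | τ , τ∈ , refl = trans (cong sum (removeAt-insertAt τ middle (N ∸ j)))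
                              (proj₂ (proj₁ (Equivalence.to ∈-antiPalindromicCompositions τ∈)))

  outerSum-withOuterSumBelow : ∀ j {σ} → σ ∈ withOuterSumBelow j → outerSum σ < j
  outerSum-withOuterSumBelow (suc j) σ∈ with ∈-++⁻ (withOuterSumBelow j) σ∈
  ... | inj₁ σ∈ʳ = m<n⇒m<1+n (outerSum-withOuterSumBelow j σ∈ʳ)
  ... | inj₂ σ∈ᵇ = s≤s (≤-reflexive (outerSum-block σ∈ᵇ))

  withOuterSumBelow-unique : ∀ j → Unique (withOuterSumBelow j)
  withOuterSumBelow-unique zero    = []
  withOuterSumBelow-unique (suc j) =
    Unique.++⁺ (withOuterSumBelow-unique j)
      (Unique.map⁺ insertAt-middle-injective (antiPalindromicCompositions-unique j (2 * s)))
      (λ (σ∈ʳ , σ∈ᵇ) → <-irrefl (outerSum-block σ∈ᵇ) (outerSum-withOuterSumBelow j σ∈ʳ))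
    where
    insertAt-middle-injective : ∀ {τ τ′} → insertAt τ middle (N ∸ j) ≡ insertAt τ′ middle (N ∸ j) → τ ≡ τ′
    insertAt-middle-injective {τ} {τ′} eq =
      trans (sym (removeAt-insertAt τ middle (N ∸ j)))
            (trans (cong (λ σ → removeAt σ middle) eq) (removeAt-insertAt τ′ middle (N ∸ j)))

  -- The bound j ≤ N matters: for j ≥ N the truncated middle entry N ∸ j of block j is 0.
  withOuterSumBelow-sound : ∀ {j σ} → j ≤ N → σ ∈ withOuterSumBelow j →
                            AntiPalindromicComposition N (suc (2 * s)) σ
  withOuterSumBelow-sound {suc j} j<N σ∈ with ∈-++⁻ (withOuterSumBelow j) σ∈
  ... | inj₁ σ∈ʳ = withOuterSumBelow-sound (<⇒≤ j<N) σ∈ʳ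
  ... | inj₂ σ∈ᵇ with ∈-map⁻ _ σ∈ᵇ
  ... | τ , τ∈ , refl = antiPalindromicComposition-insertAt-middle⁺ τ (N ∸ j)
          (m>n⇒m∸n≢0 j<N) (m∸n+n≡m (<⇒≤ j<N)) (Equivalence.to ∈-antiPalindromicCompositions τ∈)

  withOuterSumBelow-complete : ∀ {j} (τ : Vec ℕ (2 * s)) m →
    AntiPalindromicComposition N (suc (2 * s)) (insertAt τ middle m) → sum τ < j →
    insertAt τ middle m ∈ withOuterSumBelow j
  withOuterSumBelow-complete {suc j} τ m apc τ<1+j with sum τ ≟ j
  ... | no  τ≢j = ∈-++⁺ˡ (withOuterSumBelow-complete τ m apc (≤∧≢⇒< (≤-pred τ<1+j) τ≢j))
  ... | yes refl = ∈-++⁺ʳ (withOuterSumBelow j)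
          (subst (λ k → insertAt τ middle k ∈ block (sum τ)) N∸τ≡m
                 (∈-map⁺ _ (Equivalence.from ∈-antiPalindromicCompositions apcτ)))
    where
    m+τ≡N : m + sum τ ≡ N
    m+τ≡N = proj₁ (proj₂ (antiPalindromicComposition-insertAt-middle⁻ τ m apc))
    apcτ : AntiPalindromicComposition (sum τ) (2 * s) τ
    apcτ = proj₂ (proj₂ (antiPalindromicComposition-insertAt-middle⁻ τ m apc))
    N∸τ≡m : N ∸ sum τ ≡ m
    N∸τ≡m = trans (cong (_∸ sum τ) (sym m+τ≡N)) (m+n∸n≡m m (sum τ))

  ∈-withOuterSumBelow : ∀ {σ} → σ ∈ withOuterSumBelow N ⇔ AntiPalindromicComposition N (suc (2 * s)) σ
  ∈-withOuterSumBelow {σ} = mk⇔ (withOuterSumBelow-sound ≤-refl) complete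
    where
    τ : Vec ℕ (2 * s)
    τ = removeAt σ middle
    m : ℕ
    m = lookup σ middle
    complete : AntiPalindromicComposition N (suc (2 * s)) σ → σ ∈ withOuterSumBelow N
    complete apcσ = subst (_∈ withOuterSumBelow N) (insertAt-removeAt σ middle)
                          (withOuterSumBelow-complete τ m apc τ<N)
      where
      apc : AntiPalindromicComposition N (suc (2 * s)) (insertAt τ middle m)
      apc = subst (AntiPalindromicComposition N (suc (2 * s))) (sym (insertAt-removeAt σ middle)) apcσ
      τ<N : sum τ < N
      τ<N with antiPalindromicComposition-insertAt-middle⁻ τ m apc
      ... | m≢0 , m+τ≡N , _ = subst (sum τ <_) m+τ≡N (m<n+m (sum τ) (n≢0⇒n>0 m≢0))

ac-odd-length : ∀ s n → ac n (suc (2 * s)) ≡ sumBelow n (λ j → ac j (2 * s))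
ac-odd-length s n =
  trans (ac-≡-length-of-enumeration (withOuterSumBelow-unique n) ∈-withOuterSumBelow)
        (length-withOuterSumBelow n)
  where open Enumeration s n

proposition3 : (n s : ℕ) → ac n (2 * s + 1) ≡ sumBelow n (λ j → ac j (2 * s))
proposition3 n s =
  subst (λ k → ac n k ≡ sumBelow n (λ j → ac j (2 * s))) (+-comm 1 (2 * s)) (ac-odd-length s n)
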